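{- Let $m\ge 3$ and $k\ge 2$ be integers and let $\Delta$ be a lattice simplex of dimension $d$ whose $h^*$-polynomial equals $1+(m-2)t^k+t^{2k}$. Let $x \in \Lambda_\Delta$ be an element of order $n$ and let $1 \leq j \leq n-1$ be an integer coprime to $n$. Then $\mathrm{supp}(x)=\mathrm{supp}(jx)$. Hence $$\mathrm{ht}(x)+\mathrm{ht}((n-1)x)=\mathrm{ht}(jx)+\mathrm{ht}((n-j)x).$$
   Context: A lattice simplex of dimension $d$ is a $d$-dimensional simplex in $\mathbb{R}^d$ with vertices in $\mathbb{Z}^d$; its $h^*$-polynomial is the numerator $h^*_\Delta(t)$ in the Ehrhart series $1+\sum_{k\ge1}\#(k\Delta\cap\mathbb{Z}^d)t^k=h^*_\Delta(t)/(1-t)^{d+1}$. For $\Delta$ with ordered vertices $v_0,\ldots,v_d$, $\Lambda_\Delta=\{(x_0,\ldots,x_d)\in[0,1)^{d+1}:\sum_i x_i(v_i,1)\in\mathbb{Z}^{d+1}\}$, a finite subgroup of $(\mathbb{R}/\mathbb{Z})^{d+1}$ identified with $[0,1)^{d+1}$ (addition componentwise modulo $1$; $jx$ is the $j$-fold sum). For $x\in\Lambda_\Delta$, $\mathrm{ht}(x)=\sum_{i=0}^d x_i\in\mathbb{Z}$ and $\mathrm{supp}(x)=\{i: x_i\neq 0\}$. -}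

module Defs where

open import Data.Nat as ℕ using (ℕ; zero; suc; _≤_; _<_)
open import Data.Nat.Combinatorics using (_C_)
open import Data.Integer as ℤ using (ℤ; +_)
open import Data.Rational as ℚ using (ℚ; 0ℚ; 1ℚ; floor)
open import Data.Fin using (Fin; zero; suc)
open import Data.Vec using (Vec; lookup)
open import Data.List using (List)
open import Data.List.Membership.Propositional using (_∈_)
open import Data.List.Relation.Unary.Unique.Propositional using (Unique)
open import Data.Product using (Σ; ∃; _×_)
open import Function.Bundles using (_⇔_)
open import Relation.Binary.PropositionalEquality using (_≡_)
open import Relation.Nullary using (¬_)

sumℚ : ∀ {n} → (Fin n → ℚ) → ℚ
sumℚ {zero}  f = 0ℚ
sumℚ {suc n} f = f zero ℚ.+ sumℚ (λ i → f (suc i))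

sumℤ : ℕ → (ℕ → ℤ) → ℤ
sumℤ zero    f = + 0
sumℤ (suc n) f = f zero ℤ.+ sumℤ n (λ j → f (suc j))

IsInt : ℚ → Set
IsInt q = ∃ λ (z : ℤ) → q ≡ z ℚ./ 1

Verts : ℕ → Set
Verts d = Fin (suc d) → Vec ℤ d

combo : ∀ {d} → Verts d → (Fin (suc d) → ℚ) → Fin d → ℚ
combo v λ' c = sumℚ (λ i → λ' i ℚ.* (lookup (v i) c ℚ./ 1))

-- v_0..v_d span a d-dimensional simplex: (v_i,1) linearly independent over ℚ
IsLatticeSimplex : ∀ d → Verts d → Set
IsLatticeSimplex d v = (λ' : Fin (suc d) → ℚ) →
  (∀ c → combo v λ' c ≡ 0ℚ) → sumℚ λ' ≡ 0ℚ → ∀ i → λ' i ≡ 0ℚ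

InDilate : ∀ {d} → Verts d → ℕ → Vec ℤ d → Set
InDilate {d} v k y = ∃ λ (μ : Fin (suc d) → ℚ) →
  (∀ i → 0ℚ ℚ.≤ μ i) × (sumℚ μ ≡ (+ k) ℚ./ 1) ×
  (∀ c → combo v μ c ≡ lookup y c ℚ./ 1)

-- #(kΔ ∩ ℤ^d) = N : witnessed by a duplicate-free list of exactly those points
HasLatticeCount : ∀ {d} → Verts d → ℕ → ℕ → Set
HasLatticeCount {d} v k N = ∃ λ (ps : List (Vec ℤ d)) →
  Unique ps × (Data.List.length ps ≡ N) × (∀ y → (y ∈ ps) ⇔ InDilate v k y)

-- Ehrhart series 1 + Σ_{k≥1} L(k) t^k, coefficients E
ehrCoeff : (ℕ → ℕ) → ℕ → ℤ
ehrCoeff L zero    = + 1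
ehrCoeff L (suc k) = + L (suc k)

signℤ : ℕ → ℤ
signℤ zero = + 1
signℤ (suc j) = ℤ.- signℤ j

-- coefficient of t^i in (1-t)^{d+1} · Σ_k E(k) t^k
hstarCoeff : ℕ → (ℕ → ℕ) → ℕ → ℤ
hstarCoeff d L i = sumℤ (suc i) (λ j → signℤ j ℤ.* (+ ((suc d) C j)) ℤ.* ehrCoeff L (i ℕ.∸ j))

HStarIs : ∀ d → Verts d → (ℕ → ℤ) → Set
HStarIs d v p = ∃ λ (L : ℕ → ℕ) →
  (∀ k → HasLatticeCount v (suc k) (L (suc k))) × (∀ i → hstarCoeff d L i ≡ p i)

-- coefficients of 1 + (m-2) t^k + t^{2k}  (k ≥ 2, so 0, k, 2k are distinct)
polyCoeff : ℕ → ℕ → ℕ → ℤ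
polyCoeff m k i with i ℕ.≟ 0 | i ℕ.≟ k | i ℕ.≟ 2 ℕ.* k
... | Relation.Nullary.yes _ | _ | _ = + 1
... | Relation.Nullary.no _ | Relation.Nullary.yes _ | _ = (+ m) ℤ.- (+ 2)
... | Relation.Nullary.no _ | Relation.Nullary.no _ | Relation.Nullary.yes _ = + 1
... | Relation.Nullary.no _ | Relation.Nullary.no _ | Relation.Nullary.no _ = + 0

Pt : ℕ → Set
Pt d = Fin (suc d) → ℚ

InLambda : ∀ {d} → Verts d → Pt d → Set
InLambda v x = (∀ i → (0ℚ ℚ.≤ x i) × (x i ℚ.< 1ℚ)) ×
  (∀ c → IsInt (combo v x c)) × IsInt (sumℚ x)

-- group operations on [0,1)^{d+1} (addition componentwise mod 1)
frac : ℚ → ℚ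
frac q = q ℚ.- (floor q ℚ./ 1)

addΛ : ∀ {d} → Pt d → Pt d → Pt d
addΛ x y i = frac (x i ℚ.+ y i)

zeroΛ : ∀ {d} → Pt d
zeroΛ i = 0ℚ

mulΛ : ∀ {d} → ℕ → Pt d → Pt d
mulΛ zero    x = zeroΛ
mulΛ (suc j) x = addΛ x (mulΛ j x)

HasOrder : ∀ {d} → Pt d → ℕ → Set
HasOrder x n = (1 ≤ n) × (∀ i → mulΛ n x i ≡ 0ℚ) ×
  (∀ r → 1 ≤ r → r < n → ¬ (∀ i → mulΛ r x i ≡ 0ℚ))

ht : ∀ {d} → Pt d → ℚ
ht = sumℚ

SameSupp : ∀ {d} → Pt d → Pt d → Set
SameSupp x y = ∀ i → (¬ (x i ≡ 0ℚ)) ⇔ (¬ (y i ≡ 0ℚ))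

-- Coordinatewise, (jx)ᵢ is the fractional part of j·xᵢ, so (jx)ᵢ = 0 exactly when j·xᵢ ∈ ℤ.
-- As n·xᵢ ∈ ℤ and j is invertible modulo n, Bézout gives j·xᵢ ∈ ℤ ⇔ xᵢ ∈ ℤ ⇔ xᵢ = 0.
-- For j ≤ n the entries (jx)ᵢ, ((n−j)x)ᵢ ∈ [0,1) have integral sum, which is therefore 0 or 1
-- according as (jx)ᵢ vanishes; by the first part this does not depend on j, and summing over i
-- gives the height identity.
module Submission where

open import Defs
open import Algebra.Properties.Monoid.Mult as Mult using ()
open import Data.Fin using (Fin)
open import Data.Integer as ℤ using (ℤ; +_; -[1+_])
import Data.Integer.DivMod as ℤD
import Data.Integer.Properties as ℤP
open import Data.Nat as ℕ using (ℕ; zero; suc)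
import Data.Nat.Coprimality as C
open import Data.Nat.GCD using (module Bézout)
import Data.Nat.Properties as ℕP
open import Data.Product using (_×_; _,_)
open import Data.Rational as ℚ using (ℚ; mkℚ; 0ℚ; 1ℚ; _+_; _-_; -_; _<_; _≤_; floor; *≤*; *<*)
open import Data.Rational.Properties
open import Data.Rational.Solver using (module +-*-Solver)
import Data.Rational.Unnormalised as ℚᵘ
import Data.Rational.Unnormalised.Properties as ℚᵘP
open import Function.Base using (_∘_)
open import Function.Bundles using (_⇔_; mk⇔; Equivalence)
open import Relation.Binary.PropositionalEquality
open import Relation.Nullary using (¬_; yes; no)
open import Relation.Nullary.Negation using (contraposition; contradiction)

open import Algebra.Properties.Group +-0-group using (inverseʳ-unique; x∙y⁻¹≈ε⇒x≈y)
open Mult +-0-monoid using (×-homo-+; ×-assocˡ) renaming (_×_ to _·_)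
open +-*-Solver using (solve; _:=_; _:+_; _:-_; :-_)

fromℤ : ℤ → ℚ
fromℤ z = z ℚ./ 1

fromℤ≡mkℚ : ∀ z → fromℤ z ≡ mkℚ z 0 (C.sym (C.1-coprimeTo ℤ.∣ z ∣))
fromℤ≡mkℚ z = fromℚᵘ-toℚᵘ (mkℚ z 0 _)

fromℤ-+ : ∀ a b → fromℤ (a ℤ.+ b) ≡ fromℤ a + fromℤ b
fromℤ-+ a b = toℚᵘ-injective (begin
  ℚ.toℚᵘ (fromℤ (a ℤ.+ b))               ≈⟨ toℚᵘ-fromℚᵘ (ℚᵘ.mkℚᵘ (a ℤ.+ b) 0) ⟩
  ℚᵘ.mkℚᵘ (a ℤ.+ b) 0                    ≈⟨ ℚᵘ.*≡* (cong (ℤ._* + 1) a+b≡a*1+b*1) ⟩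
  ℚᵘ.mkℚᵘ a 0 ℚᵘ.+ ℚᵘ.mkℚᵘ b 0           ≈⟨ ℚᵘP.+-cong (toℚᵘ-fromℚᵘ (ℚᵘ.mkℚᵘ a 0)) (toℚᵘ-fromℚᵘ (ℚᵘ.mkℚᵘ b 0)) ⟨
  ℚ.toℚᵘ (fromℤ a) ℚᵘ.+ ℚ.toℚᵘ (fromℤ b) ≈⟨ toℚᵘ-homo-+ (fromℤ a) (fromℤ b) ⟨
  ℚ.toℚᵘ (fromℤ a + fromℤ b)             ∎)
  where
  open ℚᵘP.≃-Reasoning
  a+b≡a*1+b*1 : a ℤ.+ b ≡ a ℤ.* + 1 ℤ.+ b ℤ.* + 1
  a+b≡a*1+b*1 = sym (cong₂ ℤ._+_ (ℤP.*-identityʳ a) (ℤP.*-identityʳ b))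

fromℤ-neg : ∀ a → fromℤ (ℤ.- a) ≡ - fromℤ a
fromℤ-neg a = inverseʳ-unique (fromℤ a) (fromℤ (ℤ.- a))
  (trans (sym (fromℤ-+ a (ℤ.- a))) (cong fromℤ (ℤP.+-inverseʳ a)))

fromℤ-cancel-< : ∀ {a b} → fromℤ a < fromℤ b → a ℤ.< b
fromℤ-cancel-< {a} {b} a<b with subst₂ _<_ (fromℤ≡mkℚ a) (fromℤ≡mkℚ b) a<b
... | *<* a*1<b*1 = subst₂ ℤ._<_ (ℤP.*-identityʳ a) (ℤP.*-identityʳ b) a*1<b*1

floor-≤ : ∀ s → fromℤ (floor s) ≤ s
floor-≤ s@(mkℚ n d _) = subst (_≤ s) (sym (fromℤ≡mkℚ (floor s)))
  (*≤* (subst (λ m → (n ℤ./ + suc d) ℤ.* + suc d ℤ.≤ m) (sym (ℤP.*-identityʳ n))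
    (ℤD.[n/d]*d≤n n (+ suc d))))

<-suc-floor : ∀ s → s < fromℤ (ℤ.suc (floor s))
<-suc-floor s@(mkℚ n d _) = subst (s <_) (sym (fromℤ≡mkℚ (ℤ.suc (floor s))))
  (*<* (subst₂ ℤ._<_ (sym (ℤP.*-identityʳ n))
    (cong (λ f → ℤ.suc f ℤ.* + suc d) (sym (ℤD.div-pos-is-/ℕ n (suc d))))
    (ℤD.n<s[n/ℕd]*d n (suc d))))

IsInt-+ : ∀ {p q} → IsInt p → IsInt q → IsInt (p + q)
IsInt-+ (a , refl) (b , refl) = a ℤ.+ b , sym (fromℤ-+ a b)

IsInt-neg : ∀ {p} → IsInt p → IsInt (- p)
IsInt-neg (a , refl) = ℤ.- a , sym (fromℤ-neg a)

IsInt-· : ∀ n {q} → IsInt q → IsInt (n · q)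
IsInt-· zero    _   = + 0 , refl
IsInt-· (suc n) q∈ℤ = IsInt-+ q∈ℤ (IsInt-· n q∈ℤ)

IsInt-cancelʳ-+ : ∀ {p q} → IsInt (p + q) → IsInt q → IsInt p
IsInt-cancelʳ-+ {p} {q} p+q∈ℤ q∈ℤ =
  subst IsInt (solve 2 (λ p q → (p :+ q) :- q := p) refl p q) (IsInt-+ p+q∈ℤ (IsInt-neg q∈ℤ))

IsInt-·-* : ∀ c {k q} → IsInt (k · q) → IsInt ((c ℕ.* k) · q)
IsInt-·-* c {k} {q} kq∈ℤ = subst IsInt (×-assocˡ q c k) (IsInt-· c kq∈ℤ)

-- Bézout gives 1 + s = t with s·q and t·q integral, and (1 + s)·q = q + s·q.
IsInt-·-coprime : ∀ {m n q} → C.Coprime m n → IsInt (m · q) → IsInt (n · q) → IsInt q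
IsInt-·-coprime {m} {n} {q} m⊥n mq∈ℤ nq∈ℤ with C.coprime-Bézout m⊥n
... | Bézout.+- a b 1+bn≡am = IsInt-cancelʳ-+
  (subst (λ t → IsInt (t · q)) (sym 1+bn≡am) (IsInt-·-* a mq∈ℤ)) (IsInt-·-* b nq∈ℤ)
... | Bézout.-+ a b 1+am≡bn = IsInt-cancelʳ-+
  (subst (λ t → IsInt (t · q)) (sym 1+am≡bn) (IsInt-·-* b nq∈ℤ)) (IsInt-·-* a mq∈ℤ)

-- A record rather than a synonym for IsInt (p - q), so that p and q are inferable.
infix 4 _~ℤ_
record _~ℤ_ (p q : ℚ) : Set where
  constructor congruent
  field difference-IsInt : IsInt (p - q)

~ℤ-reflexive : ∀ {p q} → p ≡ q → p ~ℤ q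
~ℤ-reflexive {p} refl = congruent (+ 0 , +-inverseʳ p)

~ℤ-sym : ∀ {p q} → p ~ℤ q → q ~ℤ p
~ℤ-sym {p} {q} (congruent p-q∈ℤ) =
  congruent (subst IsInt (solve 2 (λ p q → :- (p :- q) := q :- p) refl p q) (IsInt-neg p-q∈ℤ))

~ℤ-trans : ∀ {p q r} → p ~ℤ q → q ~ℤ r → p ~ℤ r
~ℤ-trans {p} {q} {r} (congruent p-q∈ℤ) (congruent q-r∈ℤ) =
  congruent (subst IsInt (solve 3 (λ p q r → (p :- q) :+ (q :- r) := p :- r) refl p q r)
    (IsInt-+ p-q∈ℤ q-r∈ℤ))

~ℤ-+-cong : ∀ {p q r s} → p ~ℤ q → r ~ℤ s → p + r ~ℤ q + s
~ℤ-+-cong {p} {q} {r} {s} (congruent p-q∈ℤ) (congruent r-s∈ℤ) =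
  congruent (subst IsInt (solve 4 (λ p q r s → (p :- q) :+ (r :- s) := (p :+ r) :- (q :+ s)) refl p q r s)
    (IsInt-+ p-q∈ℤ r-s∈ℤ))

IsInt-resp-~ℤ : ∀ {p q} → p ~ℤ q → IsInt q → IsInt p
IsInt-resp-~ℤ {p} {q} (congruent p-q∈ℤ) q∈ℤ =
  subst IsInt (solve 2 (λ p q → (p :- q) :+ q := p) refl p q) (IsInt-+ p-q∈ℤ q∈ℤ)

frac-~ℤ : ∀ s → frac s ~ℤ s
frac-~ℤ s = congruent (ℤ.- floor s , (begin
  frac s - s                  ≡⟨ solve 2 (λ s f → (s :- f) :- s := :- f) refl s (fromℤ (floor s)) ⟩
  - fromℤ (floor s)           ≡⟨ sym (fromℤ-neg (floor s)) ⟩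
  fromℤ (ℤ.- floor s)         ∎))
  where open ≡-Reasoning

InUnitInterval : ℚ → Set
InUnitInterval q = 0ℚ ≤ q × q < 1ℚ

frac-InUnitInterval : ∀ s → InUnitInterval (frac s)
frac-InUnitInterval s =
  subst (_≤ frac s) (+-inverseʳ f) (+-monoˡ-≤ (- f) (floor-≤ s)) ,
  subst (frac s <_) f+1-f≡1 (+-monoˡ-< (- f) (<-suc-floor s))
  where
  f = fromℤ (floor s)
  f+1-f≡1 : fromℤ (ℤ.suc (floor s)) - f ≡ 1ℚ
  f+1-f≡1 = trans (cong (_- f) (fromℤ-+ (+ 1) (floor s)))
                  (solve 2 (λ o f → (o :+ f) :- f := o) refl 1ℚ f)

IsInt-between-±1⇒≡0 : ∀ {t} → IsInt t → - 1ℚ < t → t < 1ℚ → t ≡ 0ℚ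
IsInt-between-±1⇒≡0 (z , refl) -1<z z<1 =
  cong fromℤ (zero-between (fromℤ-cancel-< {b = z} -1<z) (fromℤ-cancel-< {z} z<1))
  where
  zero-between : ∀ {z} → -[1+ 0 ] ℤ.< z → z ℤ.< + 1 → z ≡ + 0
  zero-between {+ zero}    _ _                       = refl
  zero-between {+ suc _}   _ (ℤ.+<+ (ℕ.s≤s ()))
  zero-between { -[1+ _ ]} (ℤ.-<- ()) _

InUnitInterval-~ℤ⇒≡ : ∀ {p q} → InUnitInterval p → InUnitInterval q → p ~ℤ q → p ≡ q
InUnitInterval-~ℤ⇒≡ {p} {q} (0≤p , p<1) (0≤q , q<1) (congruent p-q∈ℤ) = x∙y⁻¹≈ε⇒x≈y p q
  (IsInt-between-±1⇒≡0 p-q∈ℤ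
    (+-mono-≤-< 0≤p (neg-antimono-< q<1))
    (+-mono-<-≤ p<1 (neg-antimono-≤ 0≤q)))

InUnitInterval-IsInt⇒≡0 : ∀ {p} → InUnitInterval p → IsInt p → p ≡ 0ℚ
InUnitInterval-IsInt⇒≡0 {p} p∈I p∈ℤ =
  InUnitInterval-~ℤ⇒≡ p∈I (≤-refl , *<* (ℤ.+<+ (ℕ.s≤s ℕ.z≤n)))
    (congruent (subst IsInt (sym (+-identityʳ p)) p∈ℤ))

≤∧≢⇒< : ∀ {p q} → p ≤ q → p ≢ q → p < q
≤∧≢⇒< {p} {q} p≤q p≢q with q ≤? p
... | yes q≤p = contradiction (≤-antisym p≤q q≤p) p≢q
... | no  q≰p = ≰⇒> q≰p

IsInt-+-≡0 : ∀ {a b} → InUnitInterval b → IsInt (a + b) → a ≡ 0ℚ → a + b ≡ 0ℚ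
IsInt-+-≡0 {b = b} b∈I a+b∈ℤ refl =
  InUnitInterval-IsInt⇒≡0 (subst InUnitInterval (sym (+-identityˡ b)) b∈I) a+b∈ℤ

IsInt-+-≡1 : ∀ {a b} → InUnitInterval a → InUnitInterval b → IsInt (a + b) → a ≢ 0ℚ → a + b ≡ 1ℚ
IsInt-+-≡1 {a} {b} (0≤a , a<1) (0≤b , b<1) a+b∈ℤ a≢0 = x∙y⁻¹≈ε⇒x≈y (a + b) 1ℚ
  (IsInt-between-±1⇒≡0 (IsInt-+ a+b∈ℤ (IsInt-neg (+ 1 , refl)))
    (+-monoˡ-< (- 1ℚ) (+-mono-<-≤ (≤∧≢⇒< 0≤a (a≢0 ∘ sym)) 0≤b))
    (+-monoˡ-< (- 1ℚ) (+-mono-< a<1 b<1)))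

-- Each integral sum is 0 or 1 according as its first entry vanishes.
complementary-sums-≡ : ∀ {a b a′ b′} →
  InUnitInterval a → InUnitInterval b → InUnitInterval a′ → InUnitInterval b′ →
  IsInt (a + b) → IsInt (a′ + b′) → (a ≡ 0ℚ ⇔ a′ ≡ 0ℚ) → a + b ≡ a′ + b′
complementary-sums-≡ {a} a∈I b∈I a′∈I b′∈I a+b∈ℤ a′+b′∈ℤ a≡0⇔a′≡0 with a ≟ 0ℚ
... | yes a≡0 = trans (IsInt-+-≡0 b∈I a+b∈ℤ a≡0)
  (sym (IsInt-+-≡0 b′∈I a′+b′∈ℤ (Equivalence.to a≡0⇔a′≡0 a≡0)))
... | no a≢0 = trans (IsInt-+-≡1 a∈I b∈I a+b∈ℤ a≢0)
  (sym (IsInt-+-≡1 a′∈I b′∈I a′+b′∈ℤ (contraposition (Equivalence.from a≡0⇔a′≡0) a≢0)))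

IsInt-·-split : ∀ {j n q} → j ℕ.≤ n → IsInt (n · q) → IsInt (j · q + (n ℕ.∸ j) · q)
IsInt-·-split {j} {n} {q} j≤n nq∈ℤ = subst IsInt (×-homo-+ q j (n ℕ.∸ j))
  (subst (λ m → IsInt (m · q)) (sym (ℕP.m+[n∸m]≡n j≤n)) nq∈ℤ)

module _ {d} (x : Pt d) (i : Fin (suc d)) where

  mulΛ-InUnitInterval : ∀ j → InUnitInterval (mulΛ j x i)
  mulΛ-InUnitInterval zero    = ≤-refl , *<* (ℤ.+<+ (ℕ.s≤s ℕ.z≤n))
  mulΛ-InUnitInterval (suc j) = frac-InUnitInterval (x i + mulΛ j x i)

  mulΛ-~ℤ-· : ∀ j → mulΛ j x i ~ℤ j · x i
  mulΛ-~ℤ-· zero    = ~ℤ-reflexive refl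
  mulΛ-~ℤ-· (suc j) =
    ~ℤ-trans (frac-~ℤ (x i + mulΛ j x i)) (~ℤ-+-cong (~ℤ-reflexive {x i} refl) (mulΛ-~ℤ-· j))

  mulΛ≡0⇔IsInt : ∀ j → mulΛ j x i ≡ 0ℚ ⇔ IsInt (j · x i)
  mulΛ≡0⇔IsInt j = mk⇔
    (λ jx≡0 → IsInt-resp-~ℤ (~ℤ-sym (mulΛ-~ℤ-· j)) (+ 0 , jx≡0))
    (λ jx∈ℤ → InUnitInterval-IsInt⇒≡0 (mulΛ-InUnitInterval j) (IsInt-resp-~ℤ (mulΛ-~ℤ-· j) jx∈ℤ))

  module _ (xᵢ∈I : InUnitInterval (x i)) {n} (nxᵢ∈ℤ : IsInt (n · x i)) where

    ≡0⇔mulΛ-coprime≡0 : ∀ {j} → C.Coprime j n → x i ≡ 0ℚ ⇔ mulΛ j x i ≡ 0ℚ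
    ≡0⇔mulΛ-coprime≡0 {j} j⊥n = mk⇔
      (λ xᵢ≡0 → Equivalence.from (mulΛ≡0⇔IsInt j) (IsInt-· j (+ 0 , xᵢ≡0)))
      (λ jxᵢ≡0 → InUnitInterval-IsInt⇒≡0 xᵢ∈I
        (IsInt-·-coprime j⊥n (Equivalence.to (mulΛ≡0⇔IsInt j) jxᵢ≡0) nxᵢ∈ℤ))

    mulΛ-+-mulΛ-∸-IsInt : ∀ {j} → j ℕ.≤ n → IsInt (mulΛ j x i + mulΛ (n ℕ.∸ j) x i)
    mulΛ-+-mulΛ-∸-IsInt {j} j≤n =
      IsInt-resp-~ℤ (~ℤ-+-cong (mulΛ-~ℤ-· j) (mulΛ-~ℤ-· (n ℕ.∸ j))) (IsInt-·-split j≤n nxᵢ∈ℤ)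

    x+mulΛ-coprime-sums-≡ : ∀ {j} → 1 ℕ.≤ n → j ℕ.≤ n → C.Coprime j n →
      x i + mulΛ (n ℕ.∸ 1) x i ≡ mulΛ j x i + mulΛ (n ℕ.∸ j) x i
    x+mulΛ-coprime-sums-≡ {j} 1≤n j≤n j⊥n = complementary-sums-≡
      xᵢ∈I (mulΛ-InUnitInterval (n ℕ.∸ 1)) (mulΛ-InUnitInterval j) (mulΛ-InUnitInterval (n ℕ.∸ j))
      (IsInt-resp-~ℤ (~ℤ-+-cong (~ℤ-reflexive (sym (+-identityʳ (x i)))) (mulΛ-~ℤ-· (n ℕ.∸ 1)))
        (IsInt-·-split 1≤n nxᵢ∈ℤ))
      (mulΛ-+-mulΛ-∸-IsInt j≤n)
      (≡0⇔mulΛ-coprime≡0 j⊥n)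

¬-cong-⇔ : ∀ {a b} {A : Set a} {B : Set b} → A ⇔ B → (¬ A) ⇔ (¬ B)
¬-cong-⇔ A⇔B = mk⇔ (contraposition (Equivalence.from A⇔B)) (contraposition (Equivalence.to A⇔B))

sumℚ-+ : ∀ {n} (f g : Fin n → ℚ) → sumℚ f + sumℚ g ≡ sumℚ (λ i → f i + g i)
sumℚ-+ {zero}  f g = +-identityˡ 0ℚ
sumℚ-+ {suc n} f g = trans
  (solve 4 (λ a A b B → (a :+ A) :+ (b :+ B) := (a :+ b) :+ (A :+ B)) refl
    (f Fin.zero) (sumℚ (f ∘ Fin.suc)) (g Fin.zero) (sumℚ (g ∘ Fin.suc)))
  (cong (_+_ (f Fin.zero + g Fin.zero)) (sumℚ-+ (f ∘ Fin.suc) (g ∘ Fin.suc)))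

sumℚ-cong : ∀ {n} {f g : Fin n → ℚ} → (∀ i → f i ≡ g i) → sumℚ f ≡ sumℚ g
sumℚ-cong {zero}  f≗g = refl
sumℚ-cong {suc n} f≗g = cong₂ _+_ (f≗g Fin.zero) (sumℚ-cong (f≗g ∘ Fin.suc))

lemma3p3 : (m k d : ℕ) → 3 ℕ.≤ m → 2 ℕ.≤ k → (v : Verts d) → IsLatticeSimplex d v →
    HStarIs d v (polyCoeff m k) →
    (x : Pt d) → InLambda v x → (n : ℕ) → HasOrder x n →
    (j : ℕ) → 1 ℕ.≤ j → j ℕ.≤ n ℕ.∸ 1 → C.Coprime j n →
    SameSupp x (mulΛ j x) ×
      (ht x + ht (mulΛ (n ℕ.∸ 1) x) ≡ ht (mulΛ j x) + ht (mulΛ (n ℕ.∸ j) x))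
lemma3p3 _ _ _ _ _ _ _ _ x (x∈I , _) n (1≤n , nx≡0 , _) j _ j≤n-1 j⊥n =
  (λ i → ¬-cong-⇔ (≡0⇔mulΛ-coprime≡0 x i (x∈I i) (nxᵢ∈ℤ i) j⊥n)) ,
  (begin
    ht x + ht (mulΛ (n ℕ.∸ 1) x)                   ≡⟨ sumℚ-+ x (mulΛ (n ℕ.∸ 1) x) ⟩
    sumℚ (λ i → x i + mulΛ (n ℕ.∸ 1) x i)          ≡⟨ sumℚ-cong coordinatewise ⟩
    sumℚ (λ i → mulΛ j x i + mulΛ (n ℕ.∸ j) x i)   ≡⟨ sumℚ-+ (mulΛ j x) (mulΛ (n ℕ.∸ j) x) ⟨
    ht (mulΛ j x) + ht (mulΛ (n ℕ.∸ j) x)          ∎)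
  where
  open ≡-Reasoning
  nxᵢ∈ℤ : ∀ i → IsInt (n · x i)
  nxᵢ∈ℤ i = Equivalence.to (mulΛ≡0⇔IsInt x i n) (nx≡0 i)
  j≤n : j ℕ.≤ n
  j≤n = ℕP.≤-trans j≤n-1 (ℕP.m∸n≤m n 1)
  coordinatewise : ∀ i → x i + mulΛ (n ℕ.∸ 1) x i ≡ mulΛ j x i + mulΛ (n ℕ.∸ j) x i
  coordinatewise i = x+mulΛ-coprime-sums-≡ x i (x∈I i) (nxᵢ∈ℤ i) 1≤n j≤n j⊥n
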